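{- The rewrite relation $\to$ on stratified formulae and terms is terminating: there is no infinite chain of rewrites $\phi_0\to\phi_1\to\phi_2\to\cdots$ (and likewise for terms).
   Context: Atoms: for each $i\in\mathbb{Z}$ fix a countably infinite set $\mathbb{A}_i$ of atoms, pairwise disjoint; $\mathrm{level}(a)=i$ iff $a\in\mathbb{A}_i$. Syntax: formulae $\phi,\psi::=\bot\mid\neg\phi\mid\phi\wedge\psi\mid\forall a.\phi\mid s\in t$ and terms $s,t::=a\mid\{a\mid\phi\}$, where $\forall a$ and $\{a\mid\cdot\}$ bind $a$, up to $\alpha$-equivalence; $\phi[a:=s]$ is capture-avoiding substitution. $\mathrm{level}(\{a\mid\phi\})=\mathrm{level}(a)+1$; a formula or term is stratified when every subformula $s'\in s$ has $\mathrm{level}(s)=\mathrm{level}(s')+1$; only stratified syntax is considered. $\to$ is the least relation containing $t\in\{a\mid\phi\}\to\phi[a:=t]$ and closed under contexts ($\neg$, either side of $\wedge$, $\forall a.$, $\{a\mid\cdot\}$, either side of $\in$). -}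

module Defs where

open import Data.Nat using (ℕ)
open import Data.Integer using (ℤ; suc)
open import Data.List using (List; []; _∷_)

-- Bound atoms are de Bruijn variables into a context of levels (this
-- realises alpha-equivalence); free atoms of level i are `atom n`,
-- n : ℕ, i.e. 𝔸_i ≅ ℕ (countably infinite, disjoint for distinct i).

Ctx : Set
Ctx = List ℤ

data Var : Ctx → ℤ → Set where
  vz : ∀ {Γ i} → Var (i ∷ Γ) i
  vs : ∀ {Γ i j} → Var Γ i → Var (j ∷ Γ) i

mutual
  data Term (Γ : Ctx) : ℤ → Set where
    atom : ∀ {i} → ℕ → Term Γ i
    var  : ∀ {i} → Var Γ i → Term Γ i
    compr : ∀ {i} → Formula (i ∷ Γ) → Term Γ (suc i)

  data Formula (Γ : Ctx) : Set where
    ⊥'   : Formula Γ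
    ¬'_  : Formula Γ → Formula Γ
    _∧'_ : Formula Γ → Formula Γ → Formula Γ
    ∀'   : ∀ {i} → Formula (i ∷ Γ) → Formula Γ
    _∈'_ : ∀ {i} → Term Γ i → Term Γ (suc i) → Formula Γ

Ren : Ctx → Ctx → Set
Ren Γ Δ = ∀ {i} → Var Γ i → Var Δ i

liftR : ∀ {Γ Δ j} → Ren Γ Δ → Ren (j ∷ Γ) (j ∷ Δ)
liftR ρ vz = vz
liftR ρ (vs x) = vs (ρ x)

mutual
  renT : ∀ {Γ Δ i} → Ren Γ Δ → Term Γ i → Term Δ i
  renT ρ (atom n) = atom n
  renT ρ (var x) = var (ρ x)
  renT ρ (compr φ) = compr (renF (liftR ρ) φ)

  renF : ∀ {Γ Δ} → Ren Γ Δ → Formula Γ → Formula Δ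
  renF ρ ⊥' = ⊥'
  renF ρ (¬' φ) = ¬' renF ρ φ
  renF ρ (φ ∧' ψ) = renF ρ φ ∧' renF ρ ψ
  renF ρ (∀' φ) = ∀' (renF (liftR ρ) φ)
  renF ρ (s ∈' t) = renT ρ s ∈' renT ρ t

Sub : Ctx → Ctx → Set
Sub Γ Δ = ∀ {i} → Var Γ i → Term Δ i

liftS : ∀ {Γ Δ j} → Sub Γ Δ → Sub (j ∷ Γ) (j ∷ Δ)
liftS σ vz = var vz
liftS σ (vs x) = renT vs (σ x)

mutual
  subT : ∀ {Γ Δ i} → Sub Γ Δ → Term Γ i → Term Δ i
  subT σ (atom n) = atom n
  subT σ (var x) = σ x
  subT σ (compr φ) = compr (subF (liftS σ) φ)

  subF : ∀ {Γ Δ} → Sub Γ Δ → Formula Γ → Formula Δ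
  subF σ ⊥' = ⊥'
  subF σ (¬' φ) = ¬' subF σ φ
  subF σ (φ ∧' ψ) = subF σ φ ∧' subF σ ψ
  subF σ (∀' φ) = ∀' (subF (liftS σ) φ)
  subF σ (s ∈' t) = subT σ s ∈' subT σ t

single : ∀ {Γ i} → Term Γ i → Sub (i ∷ Γ) Γ
single t vz = t
single t (vs x) = var x

_[_] : ∀ {Γ i} → Formula (i ∷ Γ) → Term Γ i → Formula Γ
φ [ t ] = subF (single t) φ

mutual
  data _⟶F_ {Γ : Ctx} : Formula Γ → Formula Γ → Set where
    β    : ∀ {i} {t : Term Γ i} {φ : Formula (i ∷ Γ)} → (t ∈' compr φ) ⟶F (φ [ t ])
    ¬-c  : ∀ {φ φ'} → φ ⟶F φ' → (¬' φ) ⟶F (¬' φ')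
    ∧-l  : ∀ {φ φ' ψ} → φ ⟶F φ' → (φ ∧' ψ) ⟶F (φ' ∧' ψ)
    ∧-r  : ∀ {φ ψ ψ'} → ψ ⟶F ψ' → (φ ∧' ψ) ⟶F (φ ∧' ψ')
    ∀-c  : ∀ {i} {φ φ' : Formula (i ∷ Γ)} → φ ⟶F φ' → ∀' φ ⟶F ∀' φ'
    ∈-l  : ∀ {i} {s s' : Term Γ i} {t} → s ⟶T s' → (s ∈' t) ⟶F (s' ∈' t)
    ∈-r  : ∀ {i} {s : Term Γ i} {t t'} → t ⟶T t' → (s ∈' t) ⟶F (s ∈' t')

  data _⟶T_ {Γ : Ctx} : ∀ {i} → Term Γ i → Term Γ i → Set where
    compr-c : ∀ {i} {φ φ' : Formula (i ∷ Γ)} → φ ⟶F φ' → compr φ ⟶T compr φ'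

module Submission where

open import Defs
open import Data.Nat using (ℕ; suc)
open import Data.Integer using (ℤ)
open import Data.Product using (_×_; Σ)
open import Relation.Nullary using (¬_)
open import Data.Nat using (zero; _<_)
import Data.Nat.Properties as ℕ
open import Data.Integer using (+_; -_; _+_; _-_; ∣_∣; _⊓_; _≤_; pred) renaming (suc to sucℤ)
import Data.Integer.Properties as ℤ
open import Data.List using (_∷_)
open import Data.Product using (_,_)
open import Data.Unit using (⊤; tt)
open import Function using (flip; _∘_)
open import Induction.WellFounded using (Acc; acc)
open import Induction.InfiniteDescent using (InfiniteDescendingSequence)
open import Relation.Binary.Core using (Rel)
open import Relation.Binary.Construct.Closure.ReflexiveTransitive using (Star; ε; _◅_; _◅◅_; gmap; return)
open import Relation.Binary.PropositionalEquality using (_≡_; refl; sym; trans; cong; cong₂; subst)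

-- Termination of the rewrite relation, via strong normalisation in the style
-- of the simply typed λ-calculus: the level of a term plays the role of its
-- type, and contracting  s ∈ {a | φ}  substitutes s, whose level is one below
-- that of the comprehension, into φ.

private
  variable
    Γ Δ Θ : Ctx
    i j : ℤ

_≗ᴿ_ : Ren Γ Δ → Ren Γ Δ → Set
_≗ᴿ_ {Γ} ρ ρ' = ∀ {j} (x : Var Γ j) → ρ x ≡ ρ' x

_≗ˢ_ : Sub Γ Δ → Sub Γ Δ → Set
_≗ˢ_ {Γ} σ σ' = ∀ {j} (x : Var Γ j) → σ x ≡ σ' x

liftR-cong : {ρ ρ' : Ren Γ Δ} → ρ ≗ᴿ ρ' → liftR {j = i} ρ ≗ᴿ liftR ρ'
liftR-cong e vz = refl
liftR-cong e (vs x) = cong vs (e x)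

liftS-cong : {σ σ' : Sub Γ Δ} → σ ≗ˢ σ' → liftS {j = i} σ ≗ˢ liftS σ'
liftS-cong e vz = refl
liftS-cong e (vs x) = cong (renT vs) (e x)

mutual
  renT-cong : {ρ ρ' : Ren Γ Δ} → ρ ≗ᴿ ρ' → (t : Term Γ i) → renT ρ t ≡ renT ρ' t
  renT-cong e (atom n) = refl
  renT-cong e (var x) = cong var (e x)
  renT-cong e (compr φ) = cong compr (renF-cong (liftR-cong e) φ)

  renF-cong : {ρ ρ' : Ren Γ Δ} → ρ ≗ᴿ ρ' → (φ : Formula Γ) → renF ρ φ ≡ renF ρ' φ
  renF-cong e ⊥' = refl
  renF-cong e (¬' φ) = cong ¬'_ (renF-cong e φ)
  renF-cong e (φ ∧' ψ) = cong₂ _∧'_ (renF-cong e φ) (renF-cong e ψ)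
  renF-cong e (∀' φ) = cong ∀' (renF-cong (liftR-cong e) φ)
  renF-cong e (s ∈' t) = cong₂ _∈'_ (renT-cong e s) (renT-cong e t)

mutual
  subT-cong : {σ σ' : Sub Γ Δ} → σ ≗ˢ σ' → (t : Term Γ i) → subT σ t ≡ subT σ' t
  subT-cong e (atom n) = refl
  subT-cong e (var x) = e x
  subT-cong e (compr φ) = cong compr (subF-cong (liftS-cong e) φ)

  subF-cong : {σ σ' : Sub Γ Δ} → σ ≗ˢ σ' → (φ : Formula Γ) → subF σ φ ≡ subF σ' φ
  subF-cong e ⊥' = refl
  subF-cong e (¬' φ) = cong ¬'_ (subF-cong e φ)
  subF-cong e (φ ∧' ψ) = cong₂ _∧'_ (subF-cong e φ) (subF-cong e ψ)
  subF-cong e (∀' φ) = cong ∀' (subF-cong (liftS-cong e) φ)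
  subF-cong e (s ∈' t) = cong₂ _∈'_ (subT-cong e s) (subT-cong e t)

liftR-∘ : (ρ : Ren Γ Δ) (ρ' : Ren Δ Θ) → (λ x → liftR {j = i} ρ' (liftR ρ x)) ≗ᴿ liftR (λ x → ρ' (ρ x))
liftR-∘ ρ ρ' vz = refl
liftR-∘ ρ ρ' (vs x) = refl

mutual
  ren-renT : (ρ : Ren Γ Δ) (ρ' : Ren Δ Θ) (t : Term Γ i) → renT ρ' (renT ρ t) ≡ renT (λ x → ρ' (ρ x)) t
  ren-renT ρ ρ' (atom n) = refl
  ren-renT ρ ρ' (var x) = refl
  ren-renT ρ ρ' (compr φ) =
    cong compr (trans (ren-renF (liftR ρ) (liftR ρ') φ) (renF-cong (liftR-∘ ρ ρ') φ))

  ren-renF : (ρ : Ren Γ Δ) (ρ' : Ren Δ Θ) (φ : Formula Γ) → renF ρ' (renF ρ φ) ≡ renF (λ x → ρ' (ρ x)) φ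
  ren-renF ρ ρ' ⊥' = refl
  ren-renF ρ ρ' (¬' φ) = cong ¬'_ (ren-renF ρ ρ' φ)
  ren-renF ρ ρ' (φ ∧' ψ) = cong₂ _∧'_ (ren-renF ρ ρ' φ) (ren-renF ρ ρ' ψ)
  ren-renF ρ ρ' (∀' φ) =
    cong ∀' (trans (ren-renF (liftR ρ) (liftR ρ') φ) (renF-cong (liftR-∘ ρ ρ') φ))
  ren-renF ρ ρ' (s ∈' t) = cong₂ _∈'_ (ren-renT ρ ρ' s) (ren-renT ρ ρ' t)

liftS-∘R : (ρ : Ren Γ Δ) (σ : Sub Δ Θ) → (λ x → liftS {j = i} σ (liftR ρ x)) ≗ˢ liftS (λ x → σ (ρ x))
liftS-∘R ρ σ vz = refl
liftS-∘R ρ σ (vs x) = refl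

mutual
  sub-renT : (ρ : Ren Γ Δ) (σ : Sub Δ Θ) (t : Term Γ i) → subT σ (renT ρ t) ≡ subT (λ x → σ (ρ x)) t
  sub-renT ρ σ (atom n) = refl
  sub-renT ρ σ (var x) = refl
  sub-renT ρ σ (compr φ) =
    cong compr (trans (sub-renF (liftR ρ) (liftS σ) φ) (subF-cong (liftS-∘R ρ σ) φ))

  sub-renF : (ρ : Ren Γ Δ) (σ : Sub Δ Θ) (φ : Formula Γ) → subF σ (renF ρ φ) ≡ subF (λ x → σ (ρ x)) φ
  sub-renF ρ σ ⊥' = refl
  sub-renF ρ σ (¬' φ) = cong ¬'_ (sub-renF ρ σ φ)
  sub-renF ρ σ (φ ∧' ψ) = cong₂ _∧'_ (sub-renF ρ σ φ) (sub-renF ρ σ ψ)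
  sub-renF ρ σ (∀' φ) =
    cong ∀' (trans (sub-renF (liftR ρ) (liftS σ) φ) (subF-cong (liftS-∘R ρ σ) φ))
  sub-renF ρ σ (s ∈' t) = cong₂ _∈'_ (sub-renT ρ σ s) (sub-renT ρ σ t)

liftR-∘S : (σ : Sub Γ Δ) (ρ : Ren Δ Θ) → (λ x → renT (liftR {j = i} ρ) (liftS σ x)) ≗ˢ liftS (λ x → renT ρ (σ x))
liftR-∘S σ ρ vz = refl
liftR-∘S σ ρ (vs x) = trans (ren-renT vs (liftR ρ) (σ x)) (sym (ren-renT ρ vs (σ x)))

mutual
  ren-subT : (σ : Sub Γ Δ) (ρ : Ren Δ Θ) (t : Term Γ i) → renT ρ (subT σ t) ≡ subT (λ x → renT ρ (σ x)) t
  ren-subT σ ρ (atom n) = refl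
  ren-subT σ ρ (var x) = refl
  ren-subT σ ρ (compr φ) =
    cong compr (trans (ren-subF (liftS σ) (liftR ρ) φ) (subF-cong (liftR-∘S σ ρ) φ))

  ren-subF : (σ : Sub Γ Δ) (ρ : Ren Δ Θ) (φ : Formula Γ) → renF ρ (subF σ φ) ≡ subF (λ x → renT ρ (σ x)) φ
  ren-subF σ ρ ⊥' = refl
  ren-subF σ ρ (¬' φ) = cong ¬'_ (ren-subF σ ρ φ)
  ren-subF σ ρ (φ ∧' ψ) = cong₂ _∧'_ (ren-subF σ ρ φ) (ren-subF σ ρ ψ)
  ren-subF σ ρ (∀' φ) =
    cong ∀' (trans (ren-subF (liftS σ) (liftR ρ) φ) (subF-cong (liftR-∘S σ ρ) φ))
  ren-subF σ ρ (s ∈' t) = cong₂ _∈'_ (ren-subT σ ρ s) (ren-subT σ ρ t)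

liftS-∘ : (σ : Sub Γ Δ) (τ : Sub Δ Θ) → (λ x → subT (liftS {j = i} τ) (liftS σ x)) ≗ˢ liftS (λ x → subT τ (σ x))
liftS-∘ σ τ vz = refl
liftS-∘ σ τ (vs x) = trans (sub-renT vs (liftS τ) (σ x)) (sym (ren-subT τ vs (σ x)))

mutual
  sub-subT : (σ : Sub Γ Δ) (τ : Sub Δ Θ) (t : Term Γ i) → subT τ (subT σ t) ≡ subT (λ x → subT τ (σ x)) t
  sub-subT σ τ (atom n) = refl
  sub-subT σ τ (var x) = refl
  sub-subT σ τ (compr φ) =
    cong compr (trans (sub-subF (liftS σ) (liftS τ) φ) (subF-cong (liftS-∘ σ τ) φ))

  sub-subF : (σ : Sub Γ Δ) (τ : Sub Δ Θ) (φ : Formula Γ) → subF τ (subF σ φ) ≡ subF (λ x → subT τ (σ x)) φ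
  sub-subF σ τ ⊥' = refl
  sub-subF σ τ (¬' φ) = cong ¬'_ (sub-subF σ τ φ)
  sub-subF σ τ (φ ∧' ψ) = cong₂ _∧'_ (sub-subF σ τ φ) (sub-subF σ τ ψ)
  sub-subF σ τ (∀' φ) =
    cong ∀' (trans (sub-subF (liftS σ) (liftS τ) φ) (subF-cong (liftS-∘ σ τ) φ))
  sub-subF σ τ (s ∈' t) = cong₂ _∈'_ (sub-subT σ τ s) (sub-subT σ τ t)

liftS-id : liftS {j = i} (var {Γ}) ≗ˢ var
liftS-id vz = refl
liftS-id (vs x) = refl

mutual
  sub-idT : (t : Term Γ i) → subT var t ≡ t
  sub-idT (atom n) = refl
  sub-idT (var x) = refl
  sub-idT (compr φ) = cong compr (trans (subF-cong liftS-id φ) (sub-idF φ))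

  sub-idF : (φ : Formula Γ) → subF var φ ≡ φ
  sub-idF ⊥' = refl
  sub-idF (¬' φ) = cong ¬'_ (sub-idF φ)
  sub-idF (φ ∧' ψ) = cong₂ _∧'_ (sub-idF φ) (sub-idF ψ)
  sub-idF (∀' φ) = cong ∀' (trans (subF-cong liftS-id φ) (sub-idF φ))
  sub-idF (s ∈' t) = cong₂ _∈'_ (sub-idT s) (sub-idT t)

sub-β : (σ : Sub Γ Δ) (φ : Formula (i ∷ Γ)) (t : Term Γ i) →
        subF σ (φ [ t ]) ≡ (subF (liftS σ) φ) [ subT σ t ]
sub-β σ φ t = trans (sub-subF (single t) σ φ)
                    (sym (trans (sub-subF (liftS σ) (single (subT σ t)) φ) (subF-cong pointwise φ)))
  where
  pointwise : (λ x → subT (single (subT σ t)) (liftS σ x)) ≗ˢ (λ x → subT σ (single t x))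
  pointwise vz = refl
  pointwise (vs x) = trans (sub-renT vs (single (subT σ t)) (σ x)) (sub-idT (σ x))

ren-β : (ρ : Ren Γ Δ) (φ : Formula (i ∷ Γ)) (t : Term Γ i) →
        renF ρ (φ [ t ]) ≡ (renF (liftR ρ) φ) [ renT ρ t ]
ren-β ρ φ t = trans (ren-subF (single t) ρ φ)
                    (sym (trans (sub-renF (liftR ρ) (single (renT ρ t)) φ) (subF-cong pointwise φ)))
  where
  pointwise : (λ x → single (renT ρ t) (liftR ρ x)) ≗ˢ (λ x → renT ρ (single t x))
  pointwise vz = refl
  pointwise (vs x) = refl

mutual
  renF-⟶ : (ρ : Ren Γ Δ) {φ φ' : Formula Γ} → φ ⟶F φ' → renF ρ φ ⟶F renF ρ φ'
  renF-⟶ ρ (β {t = t} {φ = φ}) = subst ((renT ρ t ∈' compr (renF (liftR ρ) φ)) ⟶F_) (sym (ren-β ρ φ t)) β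
  renF-⟶ ρ (¬-c r) = ¬-c (renF-⟶ ρ r)
  renF-⟶ ρ (∧-l r) = ∧-l (renF-⟶ ρ r)
  renF-⟶ ρ (∧-r r) = ∧-r (renF-⟶ ρ r)
  renF-⟶ ρ (∀-c r) = ∀-c (renF-⟶ (liftR ρ) r)
  renF-⟶ ρ (∈-l r) = ∈-l (renT-⟶ ρ r)
  renF-⟶ ρ (∈-r r) = ∈-r (renT-⟶ ρ r)

  renT-⟶ : (ρ : Ren Γ Δ) {t t' : Term Γ i} → t ⟶T t' → renT ρ t ⟶T renT ρ t'
  renT-⟶ ρ (compr-c r) = compr-c (renF-⟶ (liftR ρ) r)

mutual
  subF-⟶ : (σ : Sub Γ Δ) {φ φ' : Formula Γ} → φ ⟶F φ' → subF σ φ ⟶F subF σ φ'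
  subF-⟶ σ (β {t = t} {φ = φ}) = subst ((subT σ t ∈' compr (subF (liftS σ) φ)) ⟶F_) (sym (sub-β σ φ t)) β
  subF-⟶ σ (¬-c r) = ¬-c (subF-⟶ σ r)
  subF-⟶ σ (∧-l r) = ∧-l (subF-⟶ σ r)
  subF-⟶ σ (∧-r r) = ∧-r (subF-⟶ σ r)
  subF-⟶ σ (∀-c r) = ∀-c (subF-⟶ (liftS σ) r)
  subF-⟶ σ (∈-l r) = ∈-l (subT-⟶ σ r)
  subF-⟶ σ (∈-r r) = ∈-r (subT-⟶ σ r)

  subT-⟶ : (σ : Sub Γ Δ) {t t' : Term Γ i} → t ⟶T t' → subT σ t ⟶T subT σ t'
  subT-⟶ σ (compr-c r) = compr-c (subF-⟶ (liftS σ) r)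

_⟶F*_ : Formula Γ → Formula Γ → Set
_⟶F*_ = Star _⟶F_

_⟶T*_ : Term Γ i → Term Γ i → Set
_⟶T*_ = Star _⟶T_

_⟶ˢ*_ : Sub Γ Δ → Sub Γ Δ → Set
_⟶ˢ*_ {Γ} σ σ' = ∀ {j} (x : Var Γ j) → σ x ⟶T* σ' x

liftS-⟶* : {σ σ' : Sub Γ Δ} → σ ⟶ˢ* σ' → liftS {j = i} σ ⟶ˢ* liftS σ'
liftS-⟶* r vz = ε
liftS-⟶* r (vs x) = gmap (renT vs) (renT-⟶ vs) (r x)

mutual
  subF-⟶* : {σ σ' : Sub Γ Δ} → σ ⟶ˢ* σ' → (φ : Formula Γ) → subF σ φ ⟶F* subF σ' φ
  subF-⟶* r ⊥' = ε
  subF-⟶* r (¬' φ) = gmap ¬'_ ¬-c (subF-⟶* r φ)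
  subF-⟶* {σ = σ} {σ'} r (φ ∧' ψ) =
    gmap (_∧' subF σ ψ) ∧-l (subF-⟶* r φ) ◅◅ gmap (subF σ' φ ∧'_) ∧-r (subF-⟶* r ψ)
  subF-⟶* r (∀' φ) = gmap ∀' ∀-c (subF-⟶* (liftS-⟶* r) φ)
  subF-⟶* {σ = σ} {σ'} r (s ∈' t) =
    gmap (_∈' subT σ t) ∈-l (subT-⟶* r s) ◅◅ gmap (subT σ' s ∈'_) ∈-r (subT-⟶* r t)

  subT-⟶* : {σ σ' : Sub Γ Δ} → σ ⟶ˢ* σ' → (t : Term Γ i) → subT σ t ⟶T* subT σ' t
  subT-⟶* r (atom n) = ε
  subT-⟶* r (var x) = r x
  subT-⟶* r (compr φ) = gmap compr compr-c (subF-⟶* (liftS-⟶* r) φ)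

single-⟶ : {s s' : Term Γ i} → s ⟶T s' → single s ⟶ˢ* single s'
single-⟶ r vz = return r
single-⟶ r (vs x) = ε

SNF : Formula Γ → Set
SNF = Acc (flip _⟶F_)

SNT : Term Γ i → Set
SNT = Acc (flip _⟶T_)

acc⇒¬descending : ∀ {a ℓ} {A : Set a} {_<_ : Rel A ℓ} (f : ℕ → A) →
                  Acc _<_ (f 0) → ¬ InfiniteDescendingSequence _<_ f
acc⇒¬descending f (acc rs) descends = acc⇒¬descending (f ∘ suc) (rs (descends 0)) (descends ∘ suc)

sn-⟶* : {φ ψ : Formula Γ} → SNF φ → φ ⟶F* ψ → SNF ψ
sn-⟶* h ε = h
sn-⟶* (acc h) (r ◅ rs) = sn-⟶* (h r) rs

sn-¬ : {φ : Formula Γ} → SNF φ → SNF (¬' φ)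
sn-¬ (acc h) = acc λ { (¬-c r) → sn-¬ (h r) }

sn-∧ : {φ ψ : Formula Γ} → SNF φ → SNF ψ → SNF (φ ∧' ψ)
sn-∧ (acc h) (acc g) = acc λ { (∧-l r) → sn-∧ (h r) (acc g) ; (∧-r r) → sn-∧ (acc h) (g r) }

sn-∀ : {φ : Formula (i ∷ Γ)} → SNF φ → SNF (∀' φ)
sn-∀ (acc h) = acc λ { (∀-c r) → sn-∀ (h r) }

sn-compr : {φ : Formula (i ∷ Γ)} → SNF φ → SNT (compr φ)
sn-compr (acc h) = acc λ { (compr-c r) → sn-compr (h r) }

sn-∈-atom : {s : Term Γ i} {n : ℕ} → SNT s → SNF (s ∈' atom n)
sn-∈-atom (acc h) = acc λ { (∈-l r) → sn-∈-atom (h r) }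

sn-∈-var : {s : Term Γ i} {x : Var Γ (sucℤ i)} → SNT s → SNF (s ∈' var x)
sn-∈-var (acc h) = acc λ { (∈-l r) → sn-∈-var (h r) }

-- A redex is SN when its parts and its contractum are: a step inside s or
-- inside ψ only rewrites the contractum ψ[s] in zero or more steps.
sn-∈-compr : {s : Term Γ i} {ψ : Formula (i ∷ Γ)} → SNT s → SNF ψ → SNF (ψ [ s ]) → SNF (s ∈' compr ψ)
sn-∈-compr {s = s} {ψ} (acc hs) (acc hψ) hψ[s] = acc λ
  { β → hψ[s]
  ; (∈-l r) → sn-∈-compr (hs r) (acc hψ) (sn-⟶* hψ[s] (subF-⟶* (single-⟶ r) ψ))
  ; (∈-r (compr-c r)) → sn-∈-compr (acc hs) (hψ r) (sn-⟶* hψ[s] (return (subF-⟶ (single s) r)))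
  }

mutual
  data SNᵢF {Γ} : Formula Γ → Set where
    ⊥ᵢ : SNᵢF ⊥'
    ¬ᵢ : {φ : Formula Γ} → SNᵢF φ → SNᵢF (¬' φ)
    ∧ᵢ : {φ ψ : Formula Γ} → SNᵢF φ → SNᵢF ψ → SNᵢF (φ ∧' ψ)
    ∀ᵢ : {φ : Formula (i ∷ Γ)} → SNᵢF φ → SNᵢF (∀' φ)
    ∈atomᵢ : {s : Term Γ i} {n : ℕ} → SNᵢT s → SNᵢF (s ∈' atom n)
    ∈varᵢ : {s : Term Γ i} {x : Var Γ (sucℤ i)} → SNᵢT s → SNᵢF (s ∈' var x)
    ∈comprᵢ : {s : Term Γ i} {ψ : Formula (i ∷ Γ)} → SNᵢT s → SNᵢF ψ → SNᵢF (ψ [ s ]) → SNᵢF (s ∈' compr ψ)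

  data SNᵢT {Γ} : Term Γ i → Set where
    atomᵢ : {n : ℕ} → SNᵢT (atom {Γ} {i} n)
    varᵢ : {x : Var Γ i} → SNᵢT (var x)
    comprᵢ : {φ : Formula (i ∷ Γ)} → SNᵢF φ → SNᵢT (compr φ)

mutual
  SNᵢF⇒SNF : {φ : Formula Γ} → SNᵢF φ → SNF φ
  SNᵢF⇒SNF ⊥ᵢ = acc λ ()
  SNᵢF⇒SNF (¬ᵢ h) = sn-¬ (SNᵢF⇒SNF h)
  SNᵢF⇒SNF (∧ᵢ h g) = sn-∧ (SNᵢF⇒SNF h) (SNᵢF⇒SNF g)
  SNᵢF⇒SNF (∀ᵢ h) = sn-∀ (SNᵢF⇒SNF h)
  SNᵢF⇒SNF (∈atomᵢ h) = sn-∈-atom (SNᵢT⇒SNT h)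
  SNᵢF⇒SNF (∈varᵢ h) = sn-∈-var (SNᵢT⇒SNT h)
  SNᵢF⇒SNF (∈comprᵢ h g k) = sn-∈-compr (SNᵢT⇒SNT h) (SNᵢF⇒SNF g) (SNᵢF⇒SNF k)

  SNᵢT⇒SNT : {t : Term Γ i} → SNᵢT t → SNT t
  SNᵢT⇒SNT atomᵢ = acc λ ()
  SNᵢT⇒SNT varᵢ = acc λ ()
  SNᵢT⇒SNT (comprᵢ h) = sn-compr (SNᵢF⇒SNF h)

-- SNᵢ is stable under renaming (needed to push SNᵢ terms under binders).
mutual
  ren-SNᵢF : (ρ : Ren Γ Δ) {φ : Formula Γ} → SNᵢF φ → SNᵢF (renF ρ φ)
  ren-SNᵢF ρ ⊥ᵢ = ⊥ᵢ
  ren-SNᵢF ρ (¬ᵢ h) = ¬ᵢ (ren-SNᵢF ρ h)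
  ren-SNᵢF ρ (∧ᵢ h g) = ∧ᵢ (ren-SNᵢF ρ h) (ren-SNᵢF ρ g)
  ren-SNᵢF ρ (∀ᵢ h) = ∀ᵢ (ren-SNᵢF (liftR ρ) h)
  ren-SNᵢF ρ (∈atomᵢ h) = ∈atomᵢ (ren-SNᵢT ρ h)
  ren-SNᵢF ρ (∈varᵢ h) = ∈varᵢ (ren-SNᵢT ρ h)
  ren-SNᵢF ρ (∈comprᵢ {s = s} {ψ} h g k) =
    ∈comprᵢ (ren-SNᵢT ρ h) (ren-SNᵢF (liftR ρ) g) (subst SNᵢF (ren-β ρ ψ s) (ren-SNᵢF ρ k))

  ren-SNᵢT : (ρ : Ren Γ Δ) {t : Term Γ i} → SNᵢT t → SNᵢT (renT ρ t)
  ren-SNᵢT ρ atomᵢ = atomᵢ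
  ren-SNᵢT ρ varᵢ = varᵢ
  ren-SNᵢT ρ (comprᵢ h) = comprᵢ (ren-SNᵢF (liftR ρ) h)

mutual
  AboveT : ℤ → Term Γ i → Set
  AboveT lo (atom {i} n) = lo ≤ i
  AboveT lo (var {i} x) = lo ≤ i
  AboveT lo (compr {i} φ) = lo ≤ sucℤ i × AboveF lo φ

  AboveF : ℤ → Formula Γ → Set
  AboveF lo ⊥' = ⊤
  AboveF lo (¬' φ) = AboveF lo φ
  AboveF lo (φ ∧' ψ) = AboveF lo φ × AboveF lo ψ
  AboveF lo (∀' φ) = AboveF lo φ
  AboveF lo (s ∈' t) = AboveT lo s × AboveT lo t

above-level : {lo : ℤ} (t : Term Γ i) → AboveT lo t → lo ≤ i
above-level (atom n) lo≤i = lo≤i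
above-level (var x) lo≤i = lo≤i
above-level (compr φ) (lo≤i , _) = lo≤i

mutual
  above-weakenT : {lo lo' : ℤ} → lo' ≤ lo → (t : Term Γ i) → AboveT lo t → AboveT lo' t
  above-weakenT le (atom n) g = ℤ.≤-trans le g
  above-weakenT le (var x) g = ℤ.≤-trans le g
  above-weakenT le (compr φ) (g , h) = ℤ.≤-trans le g , above-weakenF le φ h

  above-weakenF : {lo lo' : ℤ} → lo' ≤ lo → (φ : Formula Γ) → AboveF lo φ → AboveF lo' φ
  above-weakenF le ⊥' g = tt
  above-weakenF le (¬' φ) g = above-weakenF le φ g
  above-weakenF le (φ ∧' ψ) (g , h) = above-weakenF le φ g , above-weakenF le ψ h
  above-weakenF le (∀' φ) g = above-weakenF le φ g
  above-weakenF le (s ∈' t) (g , h) = above-weakenT le s g , above-weakenT le t h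

mutual
  lower-boundT : (t : Term Γ i) → Σ ℤ (λ lo → AboveT lo t)
  lower-boundT (atom {i} n) = i , ℤ.≤-refl
  lower-boundT (var {i} x) = i , ℤ.≤-refl
  lower-boundT (compr {i} φ) with lower-boundF φ
  ... | lo , g = sucℤ i ⊓ lo , ℤ.i⊓j≤i (sucℤ i) lo , above-weakenF (ℤ.i⊓j≤j (sucℤ i) lo) φ g

  lower-boundF : (φ : Formula Γ) → Σ ℤ (λ lo → AboveF lo φ)
  lower-boundF ⊥' = + 0 , tt
  lower-boundF (¬' φ) = lower-boundF φ
  lower-boundF (∀' φ) = lower-boundF φ
  lower-boundF (φ ∧' ψ) with lower-boundF φ | lower-boundF ψ
  ... | a , g | b , h = a ⊓ b , above-weakenF (ℤ.i⊓j≤i a b) φ g , above-weakenF (ℤ.i⊓j≤j a b) ψ h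
  lower-boundF (s ∈' t) with lower-boundT s | lower-boundT t
  ... | a , g | b , h = a ⊓ b , above-weakenT (ℤ.i⊓j≤i a b) s g , above-weakenT (ℤ.i⊓j≤j a b) t h

mutual
  above-renT : {lo : ℤ} (ρ : Ren Γ Δ) (t : Term Γ i) → AboveT lo t → AboveT lo (renT ρ t)
  above-renT ρ (atom n) g = g
  above-renT ρ (var x) g = g
  above-renT ρ (compr φ) (g , h) = g , above-renF (liftR ρ) φ h

  above-renF : {lo : ℤ} (ρ : Ren Γ Δ) (φ : Formula Γ) → AboveF lo φ → AboveF lo (renF ρ φ)
  above-renF ρ ⊥' g = tt
  above-renF ρ (¬' φ) g = above-renF ρ φ g
  above-renF ρ (φ ∧' ψ) (g , h) = above-renF ρ φ g , above-renF ρ ψ h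
  above-renF ρ (∀' φ) g = above-renF (liftR ρ) φ g
  above-renF ρ (s ∈' t) (g , h) = above-renT ρ s g , above-renT ρ t h

AboveSub : ℤ → Sub Γ Δ → Set
AboveSub {Γ} lo σ = ∀ {j} (x : Var Γ j) → lo ≤ j → AboveT lo (σ x)

above-liftS : {lo : ℤ} {σ : Sub Γ Δ} → AboveSub lo σ → AboveSub lo (liftS {j = i} σ)
above-liftS g vz lo≤i = lo≤i
above-liftS {σ = σ} g (vs x) lo≤j = above-renT vs (σ x) (g x lo≤j)

above-single : {lo : ℤ} {s : Term Γ i} → AboveT lo s → AboveSub lo (single s)
above-single g vz _ = g
above-single g (vs x) lo≤j = lo≤j

mutual
  above-subT : {lo : ℤ} {σ : Sub Γ Δ} → AboveSub lo σ → (t : Term Γ i) → AboveT lo t → AboveT lo (subT σ t)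
  above-subT g (atom n) h = h
  above-subT g (var x) h = g x h
  above-subT g (compr φ) (h , k) = h , above-subF (above-liftS g) φ k

  above-subF : {lo : ℤ} {σ : Sub Γ Δ} → AboveSub lo σ → (φ : Formula Γ) → AboveF lo φ → AboveF lo (subF σ φ)
  above-subF g ⊥' h = tt
  above-subF g (¬' φ) h = above-subF g φ h
  above-subF g (φ ∧' ψ) (h , k) = above-subF g φ h , above-subF g ψ k
  above-subF g (∀' φ) h = above-subF (above-liftS g) φ h
  above-subF g (s ∈' t) (h , k) = above-subT g s h , above-subT g t k

-- A term of successor level is an atom, a variable, or a comprehension over
-- the level below.  (ℤ's suc is not a constructor, so Agda cannot make this
-- case split on its own.)
data SuccView {Γ j} : Term Γ (sucℤ j) → Set where
  atom : (n : ℕ) → SuccView (atom n)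
  var : (x : Var Γ (sucℤ j)) → SuccView (var x)
  compr : (χ : Formula (j ∷ Γ)) → SuccView (compr χ)

sucℤ-injective : sucℤ i ≡ sucℤ j → i ≡ j
sucℤ-injective {i} {j} e = trans (sym (ℤ.pred-suc i)) (trans (cong pred e) (ℤ.pred-suc j))

succView : (t : Term Γ (sucℤ j)) → SuccView {Γ} {j} t
succView {Γ} {j} t = view t refl
  where
  view : ∀ {J} (t : Term Γ J) (e : J ≡ sucℤ j) → SuccView {Γ} {j} (subst (Term Γ) e t)
  view (atom n) refl = atom n
  view (var x) refl = var x
  view (compr {i} χ) e with refl ← sucℤ-injective {i} {j} e with refl ← e = compr χ

module Hereditary (lo : ℤ) where

  rank : ℤ → ℕ
  rank j = ∣ j - lo ∣

  rank-pred : ∀ {j k} → lo ≤ j → rank (sucℤ j) < suc k → rank j < k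
  rank-pred {j} lo≤j r< = ℕ.≤-pred (subst (_< _) rank-suc r<)
    where
    abs-suc : ∀ d → + 0 ≤ d → ∣ + 1 + d ∣ ≡ suc ∣ d ∣
    abs-suc (+ n) _ = refl

    rank-suc : rank (sucℤ j) ≡ suc (rank j)
    rank-suc = trans (cong ∣_∣ (ℤ.+-assoc (+ 1) j (- lo))) (abs-suc (j - lo) (ℤ.i≤j⇒0≤j-i lo≤j))

  data Admissible (k : ℕ) {Δ} : Term Δ j → Set where
    var : (y : Var Δ j) → Admissible k (var y)
    bounded : {t : Term Δ j} → SNᵢT t → AboveT lo t → lo ≤ j → rank j < k → Admissible k t

  Admissibleˢ : ℕ → Sub Γ Δ → Set
  Admissibleˢ {Γ} k σ = ∀ {j} (x : Var Γ j) → Admissible k (σ x)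

  admissible-self : {t : Term Δ j} → SNᵢT t → AboveT lo t → Admissible (suc (rank j)) t
  admissible-self {t = t} h g = bounded h g (above-level t g) (ℕ.n<1+n _)

  admissible⇒above : ∀ {k} {σ : Sub Γ Δ} → Admissibleˢ k σ → AboveSub lo σ
  admissible⇒above {σ = σ} a x lo≤j with σ x | a x
  ... | _ | var y = lo≤j
  ... | _ | bounded _ g _ _ = g

  admissible-liftS : ∀ {k} {σ : Sub Γ Δ} → Admissibleˢ k σ → Admissibleˢ k (liftS {j = i} σ)
  admissible-liftS a vz = var vz
  admissible-liftS {σ = σ} a (vs x) with σ x | a x
  ... | _ | var y = var (vs y)
  ... | t | bounded h g lo≤j r< = bounded (ren-SNᵢT vs h) (above-renT vs t g) lo≤j r<

  admissible-single : ∀ {k} {s : Term Γ i} → Admissible k s → Admissibleˢ k (single s)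
  admissible-single a vz = a
  admissible-single a (vs x) = var x

  -- Induction on k, then on the SNᵢ derivation: the
  -- only new redexes are  s ∈ σ(x)  with σ(x) a comprehension, whose
  -- contractum is a substitution of strictly smaller rank.
  mutual
    sub-SNᵢF : ∀ k {σ : Sub Γ Δ} {φ : Formula Γ} → Admissibleˢ k σ → SNᵢF φ → AboveF lo φ → SNᵢF (subF σ φ)
    sub-SNᵢF k a ⊥ᵢ _ = ⊥ᵢ
    sub-SNᵢF k a (¬ᵢ h) g = ¬ᵢ (sub-SNᵢF k a h g)
    sub-SNᵢF k a (∧ᵢ h h') (g , g') = ∧ᵢ (sub-SNᵢF k a h g) (sub-SNᵢF k a h' g')
    sub-SNᵢF k a (∀ᵢ h) g = ∀ᵢ (sub-SNᵢF k (admissible-liftS a) h g)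
    sub-SNᵢF k a (∈atomᵢ h) (g , _) = ∈atomᵢ (sub-SNᵢT k a h g)
    sub-SNᵢF k a (∈varᵢ {s = s} {x} h) (g , _) =
      ∈-admissible k (a x) (sub-SNᵢT k a h g) (above-subT (admissible⇒above a) s g) (above-level s g)
    sub-SNᵢF k {σ} a (∈comprᵢ {s = s} {ψ} h h' h'') (g , _ , gψ) =
      ∈comprᵢ (sub-SNᵢT k a h g) (sub-SNᵢF k (admissible-liftS a) h' gψ)
              (subst SNᵢF (sub-β σ ψ s) (sub-SNᵢF k a h'' (above-subF (above-single g) ψ gψ)))

    sub-SNᵢT : ∀ k {σ : Sub Γ Δ} {t : Term Γ i} → Admissibleˢ k σ → SNᵢT t → AboveT lo t → SNᵢT (subT σ t)
    sub-SNᵢT k a atomᵢ _ = atomᵢ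
    sub-SNᵢT k {σ} a (varᵢ {x = x}) _ with σ x | a x
    ... | _ | var y = varᵢ
    ... | _ | bounded h _ _ _ = h
    sub-SNᵢT k a (comprᵢ h) (_ , g) = comprᵢ (sub-SNᵢF k (admissible-liftS a) h g)

    ∈-admissible : ∀ k {s : Term Δ j} {t : Term Δ (sucℤ j)} → Admissible k t → SNᵢT s → AboveT lo s → lo ≤ j → SNᵢF (s ∈' t)
    ∈-admissible {j = j} k {t = t} a hs gs lo≤j with succView {j = j} t
    ... | atom n = ∈atomᵢ hs
    ... | var y = ∈varᵢ hs
    ∈-admissible zero (bounded _ _ _ ()) hs gs lo≤j | compr χ
    ∈-admissible (suc k) (bounded (comprᵢ hχ) (_ , gχ) _ r<) hs gs lo≤j | compr χ =
      ∈comprᵢ hs hχ (sub-SNᵢF k (admissible-single (bounded hs gs lo≤j (rank-pred lo≤j r<))) hχ gχ)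

-- Every formula (term) whose levels are at least lo is SNᵢ; at a membership
-- s ∈ t the container t is admissible, so the hereditary lemma applies.
mutual
  all-SNᵢF : (lo : ℤ) (φ : Formula Γ) → AboveF lo φ → SNᵢF φ
  all-SNᵢF lo ⊥' _ = ⊥ᵢ
  all-SNᵢF lo (¬' φ) g = ¬ᵢ (all-SNᵢF lo φ g)
  all-SNᵢF lo (φ ∧' ψ) (g , h) = ∧ᵢ (all-SNᵢF lo φ g) (all-SNᵢF lo ψ h)
  all-SNᵢF lo (∀' φ) g = ∀ᵢ (all-SNᵢF lo φ g)
  all-SNᵢF lo (s ∈' t) (g , h) =
    ∈-admissible _ (admissible-self (all-SNᵢT lo t h) h) (all-SNᵢT lo s g) g (above-level s g)
    where open Hereditary lo

  all-SNᵢT : (lo : ℤ) (t : Term Γ i) → AboveT lo t → SNᵢT t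
  all-SNᵢT lo (atom n) _ = atomᵢ
  all-SNᵢT lo (var x) _ = varᵢ
  all-SNᵢT lo (compr φ) (_ , g) = comprᵢ (all-SNᵢF lo φ g)

sn-formula : (φ : Formula Γ) → SNF φ
sn-formula φ = let lo , g = lower-boundF φ in SNᵢF⇒SNF (all-SNᵢF lo φ g)

sn-term : (t : Term Γ i) → SNT t
sn-term t = let lo , g = lower-boundT t in SNᵢT⇒SNT (all-SNᵢT lo t g)

proposition5p28 : (∀ (Γ : Ctx) → ¬ Σ (ℕ → Formula Γ) (λ f → ∀ n → f n ⟶F f (suc n)))
    × (∀ (Γ : Ctx) (i : ℤ) → ¬ Σ (ℕ → Term Γ i) (λ f → ∀ n → f n ⟶T f (suc n)))
proposition5p28 = (λ { Γ (f , chain) → acc⇒¬descending f (sn-formula (f 0)) chain })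
                , (λ { Γ i (f , chain) → acc⇒¬descending f (sn-term (f 0)) chain })
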